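{- For any $m$-colored composition $\alpha$, the antipode $S_m$ of $\mathcal{Q}sym^{(m)}$ satisfies \[S_m(M^{(m)}_{\alpha}) = (-1)^{l(\alpha)}\sum_{\beta \leq \alpha} M^{(m)}_{\overleftarrow{\beta}},\] where for $\beta=(\beta_1,\ldots,\beta_k)$ (colored parts), $\overleftarrow{\beta} = (\beta_k, \beta_{k-1}, \ldots, \beta_1)$.
   Context: Fix $m\ge1$, $\omega$ a primitive $m$th root of unity. An $m$-colored composition of $n$ is $\alpha=(\omega^{j_1}\alpha_1,\ldots,\omega^{j_k}\alpha_k)$ with positive integers $\alpha_i$ summing to $n$ and colors $j_i\in\{0,\ldots,m-1\}$; $l(\alpha)=k$. The refinement order on $m$-colored compositions of $n$ is generated by the covering relations $(\ldots,\omega^{j}(\alpha_i+\alpha_{i+1}),\ldots)<(\ldots,\omega^{j}\alpha_i,\omega^{j}\alpha_{i+1},\ldots)$ (splitting a part into two consecutive parts of the same color); so $\beta\le\alpha$ means $\beta$ is obtained from $\alpha$ by merging consecutive parts of equal color. In variables $x_{i,j}$, $M^{(m)}_\alpha=\sum x_{i_1,j_1}^{\alpha_1}\cdots x_{i_k,j_k}^{\alpha_k}$ summed over $i_1,\ldots,i_k$ with $(i_1,j_1)<\cdots<(i_k,j_k)$ lexicographically. $\mathcal{Q}sym^{(m)}$ is the span of all $M^{(m)}_\alpha$ (with $M^{(m)}_{()}=1$), a graded connected Hopf algebra with the usual product of power series, counit the constant term, and coproduct $\Delta_m(M^{(m)}_\alpha)=\sum_{\beta\gamma=\alpha}M^{(m)}_\beta\otimes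 M^{(m)}_\gamma$ (sum over concatenations); $S_m$ denotes its antipode. -}

module Defs where

open import Data.Nat using (ℕ; zero; suc; _∸_; _<_; _≤?_)
open import Data.Nat.Properties using () renaming (_≟_ to _≟ℕ_)
open import Data.Integer as ℤ using (ℤ; +_; -_; 0ℤ; 1ℤ)
open import Data.Fin using (Fin)
open import Data.Fin.Properties using () renaming (_≟_ to _≟F_)
open import Data.Vec as Vec using (Vec; []; _∷_; allFin)
open import Data.List as List using (List; []; _∷_; map; concatMap; filter; upTo; take; drop; length; foldr; _++_)
open import Data.List.Relation.Unary.All using (All)
open import Data.List.Properties using (≡-dec)
open import Data.Product using (Σ; _×_; _,_; proj₁; proj₂)
open import Data.Product.Properties using () renaming (≡-dec to ×-≡-dec)
open import Relation.Binary.Construct.Closure.ReflexiveTransitive using (Star)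
open import Relation.Binary.PropositionalEquality using (_≡_)
open import Relation.Nullary.Decidable using (⌊_⌋; Dec)
open import Data.Bool using (if_then_else_)

-- A colored part ω^j a is the pair (j , a) : Fin m × ℕ.
-- A (possibly ill-formed) word of colored parts:

Part : ℕ → Set
Part m = Fin m × ℕ

Word : ℕ → Set
Word m = List (Part m)

IsComp : ∀ {m} → Word m → Set
IsComp = All (λ p → 0 < proj₂ p)

len : ∀ {m} → Word m → ℕ
len = length

rev : ∀ {m} → Word m → Word m
rev = List.reverse

data _⋖_ {m : ℕ} : Word m → Word m → Set where
  merge : (pre suf : Word m) (j : Fin m) (a b : ℕ) → 0 < a → 0 < b →
          (pre ++ (j , a Data.Nat.+ b) ∷ suf) ⋖ (pre ++ (j , a) ∷ (j , b) ∷ suf)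

_≼_ : ∀ {m} → Word m → Word m → Set
_≼_ = Star _⋖_

-- Formal power series in the variables x_{i,j} (i ∈ ℕ, j ∈ Fin m), over ℤ.
--
-- A monomial is given by its exponents, row i being the vector
-- (e_{i,0}, …, e_{i,m-1}); rows beyond the list are zero.
-- (Appending zero rows gives the same monomial; all series defined below
-- are invariant under this, and equality of series is tested on every list.)

Mono : ℕ → Set
Mono m = List (Vec ℕ m)

PS : ℕ → Set
PS m = Mono m → ℤ

_≈_ : ∀ {m} → PS m → PS m → Set
f ≈ g = ∀ e → f e ≡ g e

infix 4 _≈_

0ₚ : ∀ {m} → PS m
0ₚ _ = 0ℤ

_+ₚ_ : ∀ {m} → PS m → PS m → PS m
(f +ₚ g) e = f e ℤ.+ g e

_·ₚ_ : ∀ {m} → ℤ → PS m → PS m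
(c ·ₚ f) e = c ℤ.* f e

sumₚ : ∀ {m} → List (PS m) → PS m
sumₚ = foldr _+ₚ_ 0ₚ

sumℤ : List ℤ → ℤ
sumℤ = foldr ℤ._+_ 0ℤ

splitsℕ : ℕ → List (ℕ × ℕ)
splitsℕ n = map (λ k → k , n ∸ k) (upTo (suc n))

splitsVec : ∀ {k} → Vec ℕ k → List (Vec ℕ k × Vec ℕ k)
splitsVec []      = ([] , []) ∷ []
splitsVec (n ∷ v) =
  concatMap (λ ab → map (λ uw → (proj₁ ab ∷ proj₁ uw) , (proj₂ ab ∷ proj₂ uw)) (splitsVec v))
            (splitsℕ n)

splitsMono : ∀ {m} → Mono m → List (Mono m × Mono m)
splitsMono []      = ([] , []) ∷ []
splitsMono (r ∷ e) =
  concatMap (λ ab → map (λ uw → (proj₁ ab ∷ proj₁ uw) , (proj₂ ab ∷ proj₂ uw)) (splitsMono e))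
            (splitsVec r)

_*ₚ_ : ∀ {m} → PS m → PS m → PS m
(f *ₚ g) e = sumℤ (map (λ ab → f (proj₁ ab) ℤ.* g (proj₂ ab)) (splitsMono e))

infixl 7 _*ₚ_
infixl 6 _+ₚ_

isZeroMono : ∀ {m} → Mono m → Data.Bool.Bool
isZeroMono e = foldr (λ r b → Vec.foldr _ (λ n b → ⌊ n ≟ℕ 0 ⌋ Data.Bool.∧ b) Data.Bool.true r Data.Bool.∧ b) Data.Bool.true e

1ₚ : ∀ {m} → PS m
1ₚ e = if isZeroMono e then 1ℤ else 0ℤ

-- The sequence of (color , exponent) of the variables occurring in e,
-- listed in lexicographic order of the variables (i , j).
support : ∀ {m} → Mono m → Word m
support {m} e =
  filter (λ p → 1 ≤? proj₂ p) (concatMap (λ r → Vec.toList (Vec.zip (allFin m) r)) e)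

_≟W_ : ∀ {m} (α β : Word m) → Dec (α ≡ β)
_≟W_ = ≡-dec (×-≡-dec _≟F_ _≟ℕ_)

-- Monomial quasisymmetric function M^{(m)}_α :
-- coefficient 1 on x_{i_1,j_1}^{α_1} ⋯ x_{i_k,j_k}^{α_k} with (i_1,j_1) < ⋯ < (i_k,j_k),
-- and 0 on every other monomial.
M : ∀ {m} → Word m → PS m
M α e = if ⌊ support e ≟W α ⌋ then 1ℤ else 0ℤ

εW : ∀ {m} → Word m → ℤ
εW []      = 1ℤ
εW (_ ∷ _) = 0ℤ

deconcat : ∀ {m} → Word m → List (Word m × Word m)
deconcat α = map (λ k → take k α , drop k α) (upTo (suc (length α)))

sign : ℕ → ℤ
sign zero    = 1ℤ
sign (suc k) = - sign k

-- A linear map S : Qsym^{(m)} → Qsym^{(m)} is determined by its values on the basis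
-- M_α; 'IsAntipode S' says that  μ ∘ (S ⊗ id) ∘ Δ = η ∘ ε = μ ∘ (id ⊗ S) ∘ Δ
-- on every basis element M_α.
IsAntipode : ∀ {m} → (Word m → PS m) → Set
IsAntipode {m} S =
  (∀ (α : Word m) → IsComp α →
     sumₚ (map (λ βγ → S (proj₁ βγ) *ₚ M (proj₂ βγ)) (deconcat α)) ≈ εW α ·ₚ 1ₚ)
  × (∀ (α : Word m) → IsComp α →
     sumₚ (map (λ βγ → M (proj₁ βγ) *ₚ S (proj₂ βγ)) (deconcat α)) ≈ εW α ·ₚ 1ₚ)

-- A left antipode is unique on compositions: the convolution identity ∑_{βγ=α} S β · M γ = ε α
-- determines S α from the values of S on the proper prefixes of α. So it suffices to check that
-- T β := (-1)^{l(β)} · [support ≼ ←β], to which the right-hand side evaluates, satisfies it. For α ≠ () the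
-- coefficient of a monomial x^e in ∑_k T(α₁ … α_k) · M(α_{k+1} … ) is an alternating sum over moving the
-- parts of α one at a time from the right factor to the reversed left factor; splitting every term
-- according to whether the right factor receives part of the first variable of e makes it telescope to 0.

module Submission where

open import Defs
open import Data.Nat using (ℕ; _≤_)
open import Data.List using (List; map)
open import Data.List.Relation.Unary.Unique.Propositional using (Unique)
open import Data.List.Membership.Propositional using (_∈_)
open import Function.Bundles using (_⇔_)

open import Algebra.Bundles using (AbelianGroup)
open import Data.Bool using (Bool; true; false; _∧_; _∨_; if_then_else_)
open import Data.Bool.Properties using (∨-identityʳ)
open import Data.Empty using (⊥-elim)
open import Data.Fin using (Fin)
import Data.Fin.Properties as FinP
open import Data.Integer as ℤ using (ℤ; 0ℤ; 1ℤ; -_; _+_; _*_)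
import Data.Integer.Properties as ℤP
open import Data.Integer.Tactic.RingSolver using (solve-∀)
open import Data.List as List using ([]; _∷_; _++_; upTo; concatMap; take; drop; length; null; reverse; _ʳ++_)
import Data.List.Properties as ListP
open import Data.List.Relation.Unary.All as All using (All; []; _∷_)
import Data.List.Relation.Unary.All.Properties as AllP
open import Data.List.Relation.Unary.AllPairs using ([]; _∷_)
open import Data.List.Relation.Unary.Any using (here; there)
import Data.List.Relation.Unary.Any.Properties as AnyP
open import Data.Nat as ℕ using (zero; suc; _<_; _∸_; z≤n; s≤s)
import Data.Nat.Properties as ℕP
open import Data.Product using (_×_; _,_; proj₁; proj₂)
open import Data.Sum using (_⊎_; inj₁; inj₂)
open import Data.Vec as Vec using (Vec; allFin)
open import Function using (_∘_; case_of_)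
open import Function.Bundles using (Equivalence)
open import Relation.Binary using (Tri; tri<; tri≈; tri>)
open import Relation.Binary.Construct.Closure.ReflexiveTransitive using (ε; _◅_; gmap)
open import Relation.Binary.PropositionalEquality
open import Relation.Nullary using (Dec; yes; no; ¬_)
open import Relation.Nullary.Decidable using (⌊_⌋; dec-true; dec-false; isYes≗does)

open import Algebra.Properties.CommutativeSemigroup ℤP.+-commutativeSemigroup
  using () renaming (interchange to +-interchange)
open import Algebra.Properties.CommutativeSemigroup ℤP.*-commutativeSemigroup
  using () renaming (x∙yz≈y∙xz to *-left-comm)
open import Algebra.Properties.Group (AbelianGroup.group ℤP.+-0-abelianGroup)
  using () renaming (∙-cancelˡ to +-cancelˡ)

open ≡-Reasoning

∑ : ∀ {a} {A : Set a} → List A → (A → ℤ) → ℤ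
∑ xs f = sumℤ (map f xs)

module _ {a} {A : Set a} where

  ∑-cong : (xs : List A) {f g : A → ℤ} → (∀ x → f x ≡ g x) → ∑ xs f ≡ ∑ xs g
  ∑-cong []       f≗g = refl
  ∑-cong (x ∷ xs) f≗g = cong₂ _+_ (f≗g x) (∑-cong xs f≗g)

  ∑-zero : (xs : List A) {f : A → ℤ} → (∀ x → f x ≡ 0ℤ) → ∑ xs f ≡ 0ℤ
  ∑-zero []       f≗0 = refl
  ∑-zero (x ∷ xs) f≗0 = cong₂ _+_ (f≗0 x) (∑-zero xs f≗0)

  ∑-++ : (xs ys : List A) (f : A → ℤ) → ∑ (xs ++ ys) f ≡ ∑ xs f + ∑ ys f
  ∑-++ []       ys f = sym (ℤP.+-identityˡ _)
  ∑-++ (x ∷ xs) ys f = trans (cong (f x +_) (∑-++ xs ys f)) (sym (ℤP.+-assoc (f x) _ _))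

  ∑-+ : (xs : List A) (f g : A → ℤ) → ∑ xs (λ x → f x + g x) ≡ ∑ xs f + ∑ xs g
  ∑-+ []       f g = refl
  ∑-+ (x ∷ xs) f g = trans (cong (f x + g x +_) (∑-+ xs f g)) (+-interchange (f x) (g x) _ _)

  *-∑ : (c : ℤ) (xs : List A) (f : A → ℤ) → c * ∑ xs f ≡ ∑ xs (λ x → c * f x)
  *-∑ c []       f = ℤP.*-zeroʳ c
  *-∑ c (x ∷ xs) f = trans (ℤP.*-distribˡ-+ c (f x) _) (cong (c * f x +_) (*-∑ c xs f))

module _ {a b} {A : Set a} {B : Set b} where

  ∑-map : (h : A → B) (xs : List A) (f : B → ℤ) → ∑ (map h xs) f ≡ ∑ xs (f ∘ h)
  ∑-map h []       f = refl
  ∑-map h (x ∷ xs) f = cong (f (h x) +_) (∑-map h xs f)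

  ∑-concatMap : (g : A → List B) (xs : List A) (f : B → ℤ) →
                ∑ (concatMap g xs) f ≡ ∑ xs (λ x → ∑ (g x) f)
  ∑-concatMap g []       f = refl
  ∑-concatMap g (x ∷ xs) f =
    trans (∑-++ (g x) (concatMap g xs) f) (cong (∑ (g x) f +_) (∑-concatMap g xs f))

∑-concatMap-map : ∀ {a b c} {A : Set a} {B : Set b} {C : Set c}
                  (h : A → C → B) (xs : List A) (ys : List C) (f : B → ℤ) →
                  ∑ (concatMap (λ x → map (h x) ys) xs) f ≡ ∑ xs (λ x → ∑ ys (λ y → f (h x y)))
∑-concatMap-map h xs ys f =
  trans (∑-concatMap (λ x → map (h x) ys) xs f) (∑-cong xs (λ x → ∑-map (h x) ys f))

sumₚ-apply : ∀ {a} {A : Set a} {m} (g : A → PS m) (xs : List A) e →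
             sumₚ (map g xs) e ≡ ∑ xs (λ x → g x e)
sumₚ-apply g []       e = refl
sumₚ-apply g (x ∷ xs) e = cong (g x e +_) (sumₚ-apply g xs e)

∑-upTo-suc : ∀ n (f : ℕ → ℤ) → ∑ (upTo (suc n)) f ≡ f 0 + ∑ (upTo n) (f ∘ suc)
∑-upTo-suc n f = cong (f 0 +_) (begin
  ∑ (List.applyUpTo suc n) f  ≡⟨ cong (λ l → ∑ l f) (ListP.map-upTo suc n) ⟨
  ∑ (map suc (upTo n)) f      ≡⟨ ∑-map suc (upTo n) f ⟩
  ∑ (upTo n) (f ∘ suc)        ∎)

∑-upTo-cong : ∀ n {f g : ℕ → ℤ} → (∀ k → k < n → f k ≡ g k) → ∑ (upTo n) f ≡ ∑ (upTo n) g
∑-upTo-cong zero    f≗g = refl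
∑-upTo-cong (suc n) {f} {g} f≗g = begin
  ∑ (upTo (suc n)) f           ≡⟨ ∑-upTo-suc n f ⟩
  f 0 + ∑ (upTo n) (f ∘ suc)   ≡⟨ cong₂ _+_ (f≗g 0 (s≤s z≤n))
                                            (∑-upTo-cong n (λ k k<n → f≗g (suc k) (s≤s k<n))) ⟩
  g 0 + ∑ (upTo n) (g ∘ suc)   ≡⟨ ∑-upTo-suc n g ⟨
  ∑ (upTo (suc n)) g           ∎

⟦_⟧ : Bool → ℤ
⟦ b ⟧ = if b then 1ℤ else 0ℤ

⟦∧⟧ : ∀ a b → ⟦ a ∧ b ⟧ ≡ ⟦ a ⟧ * ⟦ b ⟧
⟦∧⟧ true  true  = refl
⟦∧⟧ true  false = refl
⟦∧⟧ false b     = refl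

module _ {p} {P : Set p} where

  δ : Dec P → ℤ
  δ P? = ⟦ ⌊ P? ⌋ ⟧

  ⌊⌋-yes : (P? : Dec P) → P → ⌊ P? ⌋ ≡ true
  ⌊⌋-yes P? p = trans (isYes≗does P?) (dec-true P? p)

  ⌊⌋-no : (P? : Dec P) → ¬ P → ⌊ P? ⌋ ≡ false
  ⌊⌋-no P? ¬p = trans (isYes≗does P?) (dec-false P? ¬p)

  ⌊⌋-true⇒ : (P? : Dec P) → ⌊ P? ⌋ ≡ true → P
  ⌊⌋-true⇒ (yes p) _ = p

  δ-yes : (P? : Dec P) → P → δ P? ≡ 1ℤ
  δ-yes P? p = cong ⟦_⟧ (⌊⌋-yes P? p)

  δ-no : (P? : Dec P) → ¬ P → δ P? ≡ 0ℤ
  δ-no P? ¬p = cong ⟦_⟧ (⌊⌋-no P? ¬p)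

δ-cong : ∀ {p q} {P : Set p} {Q : Set q} (P? : Dec P) (Q? : Dec Q) → (P → Q) → (Q → P) → δ P? ≡ δ Q?
δ-cong (yes p) Q? P→Q Q→P = sym (δ-yes Q? (P→Q p))
δ-cong (no ¬p) Q? P→Q Q→P = sym (δ-no Q? (¬p ∘ Q→P))

δ-⟦⟧ : ∀ {p} {P : Set p} (P? : Dec P) b → (P → b ≡ true) → (b ≡ true → P) → δ P? ≡ ⟦ b ⟧
δ-⟦⟧ P? true  P⇒b b⇒P = δ-yes P? (b⇒P refl)
δ-⟦⟧ P? false P⇒b b⇒P = δ-no P? (λ p → case P⇒b p of λ ())

δℕ : ℕ → ℕ → ℤ
δℕ a b = δ (a ℕP.≟ b)

private
  ∑-upTo-δ∸   : ∀ n t (f : ℕ → ℤ) → t ≤ n → ∑ (upTo (suc n)) (λ k → δℕ (n ∸ k) t * f k) ≡ f (n ∸ t)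
  ∑-upTo-δ∸-> : ∀ n t (f : ℕ → ℤ) → n < t → ∑ (upTo (suc n)) (λ k → δℕ (n ∸ k) t * f k) ≡ 0ℤ

  ∑-upTo-δ∸ zero    zero f z≤n = trans (ℤP.+-identityʳ (1ℤ * f 0)) (ℤP.*-identityˡ (f 0))
  ∑-upTo-δ∸ (suc n) t    f t≤1+n with t ℕ.≤? n
  ... | yes t≤n = begin
    ∑ (upTo (suc (suc n))) (λ k → δℕ (suc n ∸ k) t * f k)
      ≡⟨ ∑-upTo-suc (suc n) (λ k → δℕ (suc n ∸ k) t * f k) ⟩
    δℕ (suc n) t * f 0 + ∑ (upTo (suc n)) (λ k → δℕ (n ∸ k) t * f (suc k))
      ≡⟨ cong₂ _+_ (cong (_* f 0) (δ-no (suc n ℕP.≟ t) (ℕP.>⇒≢ (s≤s t≤n)))) (∑-upTo-δ∸ n t (f ∘ suc) t≤n) ⟩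
    0ℤ + f (suc (n ∸ t))
      ≡⟨ ℤP.+-identityˡ _ ⟩
    f (suc (n ∸ t))
      ≡⟨ cong f (ℕP.+-∸-assoc 1 t≤n) ⟨
    f (suc n ∸ t) ∎
  ... | no t≰n with refl ← ℕP.≤-antisym t≤1+n (ℕP.≰⇒> t≰n) = begin
    ∑ (upTo (suc (suc n))) (λ k → δℕ (suc n ∸ k) (suc n) * f k)
      ≡⟨ ∑-upTo-suc (suc n) (λ k → δℕ (suc n ∸ k) (suc n) * f k) ⟩
    δℕ (suc n) (suc n) * f 0 + ∑ (upTo (suc n)) (λ k → δℕ (n ∸ k) (suc n) * f (suc k))
      ≡⟨ cong₂ _+_ (cong (_* f 0) (δ-yes (suc n ℕP.≟ suc n) refl)) (∑-upTo-δ∸-> n (suc n) (f ∘ suc) ℕP.≤-refl) ⟩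
    1ℤ * f 0 + 0ℤ
      ≡⟨ trans (ℤP.+-identityʳ _) (ℤP.*-identityˡ (f 0)) ⟩
    f 0
      ≡⟨ cong f (ℕP.n∸n≡0 n) ⟨
    f (suc n ∸ suc n) ∎

  ∑-upTo-δ∸-> zero    t f 0<t = cong (λ d → d * f 0 + 0ℤ) (δ-no (0 ℕP.≟ t) (ℕP.<⇒≢ 0<t))
  ∑-upTo-δ∸-> (suc n) t f n<t = trans (∑-upTo-suc (suc n) (λ k → δℕ (suc n ∸ k) t * f k)) (cong₂ _+_
    (cong (_* f 0) (δ-no (suc n ℕP.≟ t) (ℕP.<⇒≢ n<t)))
    (∑-upTo-δ∸-> n t (f ∘ suc) (ℕP.<-trans (ℕP.n<1+n n) n<t)))

∑-splitsℕ-select : ∀ n t (f : ℕ → ℤ) → t ≤ n →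
                   ∑ (splitsℕ n) (λ pq → δℕ (proj₂ pq) t * f (proj₁ pq)) ≡ f (n ∸ t)
∑-splitsℕ-select n t f t≤n =
  trans (∑-map (λ k → k , n ∸ k) (upTo (suc n)) (λ pq → δℕ (proj₂ pq) t * f (proj₁ pq))) (∑-upTo-δ∸ n t f t≤n)

∑-splitsℕ-select-> : ∀ n t (f : ℕ → ℤ) → n < t →
                     ∑ (splitsℕ n) (λ pq → δℕ (proj₂ pq) t * f (proj₁ pq)) ≡ 0ℤ
∑-splitsℕ-select-> n t f n<t =
  trans (∑-map (λ k → k , n ∸ k) (upTo (suc n)) (λ pq → δℕ (proj₂ pq) t * f (proj₁ pq))) (∑-upTo-δ∸-> n t f n<t)

module _ {m : ℕ} where

  rowEntries : ∀ {k} → Vec (Fin m) k → Vec ℕ k → Word m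
  rowEntries cs r = Vec.toList (Vec.zip cs r)

  -- The pairs (j , e i j) over all variables x i j in lexicographic order, zero exponents included,
  -- so that support e is positive (entries e) and splitting e is splitting each entry.
  entries : Mono m → Word m
  entries = concatMap (rowEntries (allFin m))

  positive : Word m → Word m
  positive = List.filter (λ p → 1 ℕ.≤? proj₂ p)

  positive-∷ : ∀ j (a : Word m) {p} → 0 < p → positive ((j , p) ∷ a) ≡ (j , p) ∷ positive a
  positive-∷ j a {suc p} _ = refl

  splitsW : Word m → List (Word m × Word m)
  splitsW []            = ([] , []) ∷ []
  splitsW ((j , n) ∷ c) = concatMap (λ pq → map (consSplit pq) (splitsW c)) (splitsℕ n)
    where
    consSplit : ℕ × ℕ → Word m × Word m → Word m × Word m
    consSplit (p , q) (a , b) = (j , p) ∷ a , (j , q) ∷ b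

  ∑splits : Word m → (Word m → Word m → ℤ) → ℤ
  ∑splits c F = ∑ (splitsW c) (λ ab → F (proj₁ ab) (proj₂ ab))

  ∑splits-∷ : ∀ j n c F → ∑splits ((j , n) ∷ c) F ≡
              ∑ (splitsℕ n) (λ pq → ∑splits c (λ a b → F ((j , proj₁ pq) ∷ a) ((j , proj₂ pq) ∷ b)))
  ∑splits-∷ j n c F = ∑-concatMap-map _ (splitsℕ n) (splitsW c) (λ ab → F (proj₁ ab) (proj₂ ab))

  ∑splits-cong : ∀ c {F G : Word m → Word m → ℤ} → (∀ a b → F a b ≡ G a b) → ∑splits c F ≡ ∑splits c G
  ∑splits-cong c F≗G = ∑-cong (splitsW c) (λ ab → F≗G (proj₁ ab) (proj₂ ab))

  ∑splits-zero : ∀ c {F : Word m → Word m → ℤ} → (∀ a b → F a b ≡ 0ℤ) → ∑splits c F ≡ 0ℤ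
  ∑splits-zero c F≗0 = ∑-zero (splitsW c) (λ ab → F≗0 (proj₁ ab) (proj₂ ab))

  ∑splits-++ : ∀ c d F → ∑splits (c ++ d) F ≡ ∑splits c (λ a₀ b₀ → ∑splits d (λ a b → F (a₀ ++ a) (b₀ ++ b)))
  ∑splits-++ []            d F = sym (ℤP.+-identityʳ _)
  ∑splits-++ ((j , n) ∷ c) d F = begin
    ∑splits ((j , n) ∷ c ++ d) F
      ≡⟨ ∑splits-∷ j n (c ++ d) F ⟩
    ∑ (splitsℕ n) (λ pq → ∑splits (c ++ d) (λ a b → F ((j , proj₁ pq) ∷ a) ((j , proj₂ pq) ∷ b)))
      ≡⟨ ∑-cong (splitsℕ n) (λ pq → ∑splits-++ c d (λ a b → F ((j , proj₁ pq) ∷ a) ((j , proj₂ pq) ∷ b))) ⟩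
    ∑ (splitsℕ n) (λ pq → ∑splits c (λ a₀ b₀ →
                     ∑splits d (λ a b → F ((j , proj₁ pq) ∷ a₀ ++ a) ((j , proj₂ pq) ∷ b₀ ++ b))))
      ≡⟨ ∑splits-∷ j n c (λ a₀ b₀ → ∑splits d (λ a b → F (a₀ ++ a) (b₀ ++ b))) ⟨
    ∑splits ((j , n) ∷ c) (λ a₀ b₀ → ∑splits d (λ a b → F (a₀ ++ a) (b₀ ++ b))) ∎

  private
    ∑-splitsVec-rowEntries : ∀ {k} (cs : Vec (Fin m) k) (r : Vec ℕ k) (F : Word m → Word m → ℤ) →
      ∑ (splitsVec r) (λ uw → F (rowEntries cs (proj₁ uw)) (rowEntries cs (proj₂ uw))) ≡ ∑splits (rowEntries cs r) F
    ∑-splitsVec-rowEntries Vec.[]         Vec.[]      F = refl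
    ∑-splitsVec-rowEntries (j Vec.∷ cs) (n Vec.∷ r) F =
      trans (∑-concatMap-map _ (splitsℕ n) (splitsVec r) _)
      (trans (∑-cong (splitsℕ n) (λ pq →
                ∑-splitsVec-rowEntries cs r (λ a b → F ((j , proj₁ pq) ∷ a) ((j , proj₂ pq) ∷ b))))
             (sym (∑splits-∷ j n (rowEntries cs r) F)))

  ∑-splitsMono-entries : ∀ (e : Mono m) (F : Word m → Word m → ℤ) →
    ∑ (splitsMono e) (λ uw → F (entries (proj₁ uw)) (entries (proj₂ uw))) ≡ ∑splits (entries e) F
  ∑-splitsMono-entries []      F = refl
  ∑-splitsMono-entries (r ∷ e) F = begin
    ∑ (splitsMono (r ∷ e)) (λ uw → F (entries (proj₁ uw)) (entries (proj₂ uw)))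
      ≡⟨ ∑-concatMap-map _ (splitsVec r) (splitsMono e) _ ⟩
    ∑ (splitsVec r) (λ uw → ∑ (splitsMono e) (λ uw′ →
        F (row (proj₁ uw) ++ entries (proj₁ uw′)) (row (proj₂ uw) ++ entries (proj₂ uw′))))
      ≡⟨ ∑-cong (splitsVec r) (λ uw →
           ∑-splitsMono-entries e (λ a b → F (row (proj₁ uw) ++ a) (row (proj₂ uw) ++ b))) ⟩
    ∑ (splitsVec r) (λ uw → ∑splits (entries e) (λ a b → F (row (proj₁ uw) ++ a) (row (proj₂ uw) ++ b)))
      ≡⟨ ∑-splitsVec-rowEntries (allFin m) r (λ a₀ b₀ → ∑splits (entries e) (λ a b → F (a₀ ++ a) (b₀ ++ b))) ⟩
    ∑splits (row r) (λ a₀ b₀ → ∑splits (entries e) (λ a b → F (a₀ ++ a) (b₀ ++ b)))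
      ≡⟨ ∑splits-++ (row r) (entries e) F ⟨
    ∑splits (entries (r ∷ e)) F ∎
    where
    row : Vec ℕ m → Word m
    row = rowEntries (allFin m)

  *ₚ-support : ∀ (F G : Word m → ℤ) e →
    ((F ∘ support) *ₚ (G ∘ support)) e ≡ ∑splits (entries e) (λ a b → F (positive a) * G (positive b))
  *ₚ-support F G e = ∑-splitsMono-entries e (λ a b → F (positive a) * G (positive b))

∑-*⟦∧⟧ : ∀ {a} {A : Set a} (xs : List A) (f : A → ℤ) b (c : A → Bool) →
         ∑ xs (λ x → f x * ⟦ b ∧ c x ⟧) ≡ ⟦ b ⟧ * ∑ xs (λ x → f x * ⟦ c x ⟧)
∑-*⟦∧⟧ xs f b c = begin
  ∑ xs (λ x → f x * ⟦ b ∧ c x ⟧)       ≡⟨ ∑-cong xs (λ x → cong (f x *_) (⟦∧⟧ b (c x))) ⟩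
  ∑ xs (λ x → f x * (⟦ b ⟧ * ⟦ c x ⟧)) ≡⟨ ∑-cong xs (λ x → *-left-comm (f x) ⟦ b ⟧ ⟦ c x ⟧) ⟩
  ∑ xs (λ x → ⟦ b ⟧ * (f x * ⟦ c x ⟧)) ≡⟨ *-∑ ⟦ b ⟧ xs (λ x → f x * ⟦ c x ⟧) ⟨
  ⟦ b ⟧ * ∑ xs (λ x → f x * ⟦ c x ⟧)   ∎

module _ {m : ℕ} where

  isZeroRow : ∀ {k} → Vec ℕ k → Bool
  isZeroRow = Vec.foldr _ (λ n b → ⌊ n ℕP.≟ 0 ⌋ ∧ b) true

  isZeroRow-positive : ∀ {k} (cs : Vec (Fin m) k) (r : Vec ℕ k) → isZeroRow r ≡ null (positive (rowEntries cs r))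
  isZeroRow-positive Vec.[]       Vec.[]            = refl
  isZeroRow-positive (j Vec.∷ cs) (zero Vec.∷ r)    = isZeroRow-positive cs r
  isZeroRow-positive (j Vec.∷ cs) (suc n Vec.∷ r)   = refl

  null-++ : ∀ (xs ys : Word m) → null (xs ++ ys) ≡ null xs ∧ null ys
  null-++ []      ys = refl
  null-++ (_ ∷ _) ys = refl

  isZeroMono-support : ∀ (e : Mono m) → isZeroMono e ≡ null (support e)
  isZeroMono-support []      = refl
  isZeroMono-support (r ∷ e) = begin
    isZeroRow r ∧ isZeroMono e
      ≡⟨ cong₂ _∧_ (isZeroRow-positive (allFin m) r) (isZeroMono-support e) ⟩
    null (positive (rowEntries (allFin m) r)) ∧ null (positive (entries e))
      ≡⟨ null-++ (positive (rowEntries (allFin m) r)) (positive (entries e)) ⟨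
    null (positive (rowEntries (allFin m) r) ++ positive (entries e))
      ≡⟨ cong null (ListP.filter-++ (λ p → 1 ℕ.≤? proj₂ p) (rowEntries (allFin m) r) (entries e)) ⟨
    null (support (r ∷ e)) ∎

  M[]≈1ₚ : M [] ≈ 1ₚ
  M[]≈1ₚ w = cong ⟦_⟧ (trans (≟W-[] (support w)) (sym (isZeroMono-support w)))
    where
    ≟W-[] : ∀ (v : Word m) → ⌊ v ≟W [] ⌋ ≡ null v
    ≟W-[] []      = refl
    ≟W-[] (_ ∷ _) = refl

  private
    ∑-splitsVec-isZeroRow : ∀ {k} (r : Vec ℕ k) (g : Vec ℕ k → ℤ) →
                            ∑ (splitsVec r) (λ uw → g (proj₁ uw) * ⟦ isZeroRow (proj₂ uw) ⟧) ≡ g r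
    ∑-splitsVec-isZeroRow Vec.[]      g = trans (ℤP.+-identityʳ _) (ℤP.*-identityʳ _)
    ∑-splitsVec-isZeroRow (n Vec.∷ r) g = begin
      ∑ (splitsVec (n Vec.∷ r)) (λ uw → g (proj₁ uw) * ⟦ isZeroRow (proj₂ uw) ⟧)
        ≡⟨ ∑-concatMap-map _ (splitsℕ n) (splitsVec r) _ ⟩
      ∑ (splitsℕ n) (λ pq → ∑ (splitsVec r) (λ uw →
          g (proj₁ pq Vec.∷ proj₁ uw) * ⟦ ⌊ proj₂ pq ℕP.≟ 0 ⌋ ∧ isZeroRow (proj₂ uw) ⟧))
        ≡⟨ ∑-cong (splitsℕ n) (λ pq → ∑-*⟦∧⟧ (splitsVec r) (λ uw → g (proj₁ pq Vec.∷ proj₁ uw))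
                                              ⌊ proj₂ pq ℕP.≟ 0 ⌋ (isZeroRow ∘ proj₂)) ⟩
      ∑ (splitsℕ n) (λ pq → δℕ (proj₂ pq) 0 * ∑ (splitsVec r) (λ uw →
          g (proj₁ pq Vec.∷ proj₁ uw) * ⟦ isZeroRow (proj₂ uw) ⟧))
        ≡⟨ ∑-cong (splitsℕ n) (λ pq → cong (δℕ (proj₂ pq) 0 *_)
             (∑-splitsVec-isZeroRow r (λ v → g (proj₁ pq Vec.∷ v)))) ⟩
      ∑ (splitsℕ n) (λ pq → δℕ (proj₂ pq) 0 * g (proj₁ pq Vec.∷ r))
        ≡⟨ ∑-splitsℕ-select n 0 (λ p → g (p Vec.∷ r)) z≤n ⟩
      g (n Vec.∷ r) ∎

    ∑-splitsMono-isZeroMono : ∀ (e : Mono m) (f : Mono m → ℤ) →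
                              ∑ (splitsMono e) (λ uw → f (proj₁ uw) * ⟦ isZeroMono (proj₂ uw) ⟧) ≡ f e
    ∑-splitsMono-isZeroMono []      f = trans (ℤP.+-identityʳ _) (ℤP.*-identityʳ _)
    ∑-splitsMono-isZeroMono (r ∷ e) f = begin
      ∑ (splitsMono (r ∷ e)) (λ uw → f (proj₁ uw) * ⟦ isZeroMono (proj₂ uw) ⟧)
        ≡⟨ ∑-concatMap-map _ (splitsVec r) (splitsMono e) _ ⟩
      ∑ (splitsVec r) (λ uw → ∑ (splitsMono e) (λ uw′ →
          f (proj₁ uw ∷ proj₁ uw′) * ⟦ isZeroRow (proj₂ uw) ∧ isZeroMono (proj₂ uw′) ⟧))
        ≡⟨ ∑-cong (splitsVec r) (λ uw → ∑-*⟦∧⟧ (splitsMono e) (λ uw′ → f (proj₁ uw ∷ proj₁ uw′))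
                                               (isZeroRow (proj₂ uw)) (isZeroMono ∘ proj₂)) ⟩
      ∑ (splitsVec r) (λ uw → ⟦ isZeroRow (proj₂ uw) ⟧ * ∑ (splitsMono e) (λ uw′ →
          f (proj₁ uw ∷ proj₁ uw′) * ⟦ isZeroMono (proj₂ uw′) ⟧))
        ≡⟨ ∑-cong (splitsVec r) (λ uw → cong (⟦ isZeroRow (proj₂ uw) ⟧ *_)
             (∑-splitsMono-isZeroMono e (λ v → f (proj₁ uw ∷ v)))) ⟩
      ∑ (splitsVec r) (λ uw → ⟦ isZeroRow (proj₂ uw) ⟧ * f (proj₁ uw ∷ e))
        ≡⟨ ∑-cong (splitsVec r) (λ uw → ℤP.*-comm ⟦ isZeroRow (proj₂ uw) ⟧ (f (proj₁ uw ∷ e))) ⟩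
      ∑ (splitsVec r) (λ uw → f (proj₁ uw ∷ e) * ⟦ isZeroRow (proj₂ uw) ⟧)
        ≡⟨ ∑-splitsVec-isZeroRow r (λ v → f (v ∷ e)) ⟩
      f (r ∷ e) ∎

  *ₚ-identityʳ : ∀ (f : PS m) → f *ₚ 1ₚ ≈ f
  *ₚ-identityʳ f e = ∑-splitsMono-isZeroMono e f

-- The first part of the coarser word must absorb the leading part (j′ , t) of x, either exactly or
-- leaving the remainder n ∸ t to absorb further parts; on compositions x this decides A ≼ x.
infix 7 _≼ᵇ_
_≼ᵇ_ : ∀ {m} → Word m → Word m → Bool
[]            ≼ᵇ []             = true
[]            ≼ᵇ (_ ∷ _)        = false
(_ ∷ _)       ≼ᵇ []             = false
((j , n) ∷ A) ≼ᵇ ((j′ , t) ∷ x) =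
  ⌊ j FinP.≟ j′ ⌋ ∧ (⌊ 1 ℕ.≤? t ⌋ ∧
    ((⌊ n ℕP.≟ t ⌋ ∧ A ≼ᵇ x) ∨ (⌊ suc t ℕ.≤? n ⌋ ∧ ((j , n ∸ t) ∷ A) ≼ᵇ x)))

∧-true⁻ : ∀ a b → a ∧ b ≡ true → a ≡ true × b ≡ true
∧-true⁻ true true _ = refl , refl

∨-true⁻ : ∀ a b → a ∨ b ≡ true → a ≡ true ⊎ b ≡ true
∨-true⁻ true  b _ = inj₁ refl
∨-true⁻ false b p = inj₂ p

module _ {m : ℕ} where

  ≼ᵇ-∷⁻ : ∀ j n (A : Word m) j′ t x → ((j , n) ∷ A) ≼ᵇ ((j′ , t) ∷ x) ≡ true →
          j ≡ j′ × 0 < t × ((n ≡ t × A ≼ᵇ x ≡ true) ⊎ (t < n × ((j , n ∸ t) ∷ A) ≼ᵇ x ≡ true))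
  ≼ᵇ-∷⁻ j n A j′ t x p
    with j≡j′ , p₁  ← ∧-true⁻ ⌊ j FinP.≟ j′ ⌋ _ p
    with 0<t , p₂   ← ∧-true⁻ ⌊ 1 ℕ.≤? t ⌋ _ p₁
    with ∨-true⁻ (⌊ n ℕP.≟ t ⌋ ∧ A ≼ᵇ x) _ p₂
  ... | inj₁ q with n≡t , q₁ ← ∧-true⁻ ⌊ n ℕP.≟ t ⌋ _ q =
    ⌊⌋-true⇒ (j FinP.≟ j′) j≡j′ , ⌊⌋-true⇒ (1 ℕ.≤? t) 0<t , inj₁ (⌊⌋-true⇒ (n ℕP.≟ t) n≡t , q₁)
  ... | inj₂ q with t<n , q₁ ← ∧-true⁻ ⌊ suc t ℕ.≤? n ⌋ _ q =
    ⌊⌋-true⇒ (j FinP.≟ j′) j≡j′ , ⌊⌋-true⇒ (1 ℕ.≤? t) 0<t , inj₂ (⌊⌋-true⇒ (suc t ℕ.≤? n) t<n , q₁)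

  ≼ᵇ-∷-≡ : ∀ j n (A : Word m) t x → 0 < t → n ≡ t → ((j , n) ∷ A) ≼ᵇ ((j , t) ∷ x) ≡ A ≼ᵇ x
  ≼ᵇ-∷-≡ j n A t x 0<t n≡t
    rewrite ⌊⌋-yes (j FinP.≟ j) refl | ⌊⌋-yes (1 ℕ.≤? t) 0<t | ⌊⌋-yes (n ℕP.≟ t) n≡t
          | ⌊⌋-no (suc t ℕ.≤? n) (ℕP.<-irrefl (sym n≡t))
    = ∨-identityʳ (A ≼ᵇ x)

  ≼ᵇ-∷-> : ∀ j n (A : Word m) t x → 0 < t → t < n → ((j , n) ∷ A) ≼ᵇ ((j , t) ∷ x) ≡ ((j , n ∸ t) ∷ A) ≼ᵇ x
  ≼ᵇ-∷-> j n A t x 0<t t<n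
    rewrite ⌊⌋-yes (j FinP.≟ j) refl | ⌊⌋-yes (1 ℕ.≤? t) 0<t | ⌊⌋-no (n ℕP.≟ t) (ℕP.>⇒≢ t<n)
          | ⌊⌋-yes (suc t ℕ.≤? n) t<n
    = refl

  ≼ᵇ-∷-< : ∀ j n (A : Word m) t x → n < t → ((j , n) ∷ A) ≼ᵇ ((j , t) ∷ x) ≡ false
  ≼ᵇ-∷-< j n A t x n<t
    rewrite ⌊⌋-no (n ℕP.≟ t) (ℕP.<⇒≢ n<t) | ⌊⌋-no (suc t ℕ.≤? n) (ℕP.<-asym n<t)
    = ∧-zeroʳ ⌊ j FinP.≟ j ⌋ (∧-zeroʳ ⌊ 1 ℕ.≤? t ⌋ refl)
    where
    ∧-zeroʳ : ∀ a {b} → b ≡ false → a ∧ b ≡ false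
    ∧-zeroʳ true  b≡false = b≡false
    ∧-zeroʳ false _       = refl

  ≼ᵇ-∷-≢ : ∀ j n (A : Word m) j′ t x → j ≢ j′ → ((j , n) ∷ A) ≼ᵇ ((j′ , t) ∷ x) ≡ false
  ≼ᵇ-∷-≢ j n A j′ t x j≢j′ rewrite ⌊⌋-no (j FinP.≟ j′) j≢j′ = refl

  ≼-∷ : ∀ (p : Part m) {A B : Word m} → A ≼ B → (p ∷ A) ≼ (p ∷ B)
  ≼-∷ p = gmap (p ∷_) ⋖-∷
    where
    ⋖-∷ : ∀ {A B : Word m} → A ⋖ B → (p ∷ A) ⋖ (p ∷ B)
    ⋖-∷ (merge pre suf j a b 0<a 0<b) = merge (p ∷ pre) suf j a b 0<a 0<b

  ≼ᵇ⇒≼ : ∀ (A x : Word m) → A ≼ᵇ x ≡ true → A ≼ x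
  ≼ᵇ⇒≼ []            []             _ = ε
  ≼ᵇ⇒≼ ((j , n) ∷ A) ((j′ , t) ∷ x) p with ≼ᵇ-∷⁻ j n A j′ t x p
  ... | refl , 0<t , inj₁ (refl , A≼ᵇx) = ≼-∷ (j , n) (≼ᵇ⇒≼ A x A≼ᵇx)
  ... | refl , 0<t , inj₂ (t<n , A′≼ᵇx) =
    subst (λ s → ((j , s) ∷ A) ⋖ ((j , t) ∷ (j , n ∸ t) ∷ A)) (ℕP.m+[n∸m]≡n (ℕP.<⇒≤ t<n))
          (merge [] A j t (n ∸ t) 0<t (ℕP.m<n⇒0<n∸m t<n))
    ◅ ≼-∷ (j , t) (≼ᵇ⇒≼ ((j , n ∸ t) ∷ A) x A′≼ᵇx)

  ≼ᵇ-refl : ∀ (x : Word m) → IsComp x → x ≼ᵇ x ≡ true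
  ≼ᵇ-refl []            []           = refl
  ≼ᵇ-refl ((j , t) ∷ x) (0<t ∷ comp) = trans (≼ᵇ-∷-≡ j t x t x 0<t refl) (≼ᵇ-refl x comp)

  private
    ≼ᵇ-merge-head : ∀ j a b (suf x : Word m) → 0 < a → 0 < b →
                    ((j , a) ∷ (j , b) ∷ suf) ≼ᵇ x ≡ true → ((j , a ℕ.+ b) ∷ suf) ≼ᵇ x ≡ true
    ≼ᵇ-merge-head j a b suf ((j′ , t) ∷ x) 0<a 0<b p with ≼ᵇ-∷⁻ j a ((j , b) ∷ suf) j′ t x p
    ... | refl , 0<t , inj₁ (refl , q) =
      trans (≼ᵇ-∷-> j (a ℕ.+ b) suf a x 0<a (ℕP.m<m+n a 0<b))
            (subst (λ s → ((j , s) ∷ suf) ≼ᵇ x ≡ true) (sym (ℕP.m+n∸m≡n a b)) q)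
    ... | refl , 0<t , inj₂ (t<a , q) =
      trans (≼ᵇ-∷-> j (a ℕ.+ b) suf t x 0<t (ℕP.<-≤-trans t<a (ℕP.m≤m+n a b)))
            (subst (λ s → ((j , s) ∷ suf) ≼ᵇ x ≡ true) (sym (ℕP.+-∸-comm b (ℕP.<⇒≤ t<a)))
                   (≼ᵇ-merge-head j (a ∸ t) b suf x (ℕP.m<n⇒0<n∸m t<a) 0<b q))

  ≼ᵇ-merge : ∀ (pre suf : Word m) j a b (x : Word m) → 0 < a → 0 < b →
             (pre ++ (j , a) ∷ (j , b) ∷ suf) ≼ᵇ x ≡ true → (pre ++ (j , a ℕ.+ b) ∷ suf) ≼ᵇ x ≡ true
  ≼ᵇ-merge []              suf j a b x              0<a 0<b p = ≼ᵇ-merge-head j a b suf x 0<a 0<b p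
  ≼ᵇ-merge ((j′′ , c) ∷ pre) suf j a b ((j′ , t) ∷ x) 0<a 0<b p
    with ≼ᵇ-∷⁻ j′′ c (pre ++ (j , a) ∷ (j , b) ∷ suf) j′ t x p
  ... | refl , 0<t , inj₁ (refl , q) =
    trans (≼ᵇ-∷-≡ j′′ c (pre ++ (j , a ℕ.+ b) ∷ suf) c x 0<t refl) (≼ᵇ-merge pre suf j a b x 0<a 0<b q)
  ... | refl , 0<t , inj₂ (t<c , q) =
    trans (≼ᵇ-∷-> j′′ c (pre ++ (j , a ℕ.+ b) ∷ suf) t x 0<t t<c)
          (≼ᵇ-merge ((j′′ , c ∸ t) ∷ pre) suf j a b x 0<a 0<b q)

  ≼⇒≼ᵇ : ∀ {A x : Word m} → IsComp x → A ≼ x → A ≼ᵇ x ≡ true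
  ≼⇒≼ᵇ comp ε = ≼ᵇ-refl _ comp
  ≼⇒≼ᵇ comp (merge pre suf j a b 0<a 0<b ◅ A′≼x) = ≼ᵇ-merge pre suf j a b _ 0<a 0<b (≼⇒≼ᵇ comp A′≼x)

  ⋖-reverse : ∀ {A B : Word m} → A ⋖ B → rev A ⋖ rev B
  ⋖-reverse (merge pre suf j a b 0<a 0<b) =
    subst₂ _⋖_ (sym (trans (reverse-++-∷ pre suf) (cong (λ s → reverse suf ++ (j , s) ∷ reverse pre) (ℕP.+-comm a b))))
               (sym (trans (reverse-++-∷ pre ((j , b) ∷ suf))
                           (trans (cong (_++ (j , a) ∷ reverse pre) (reverse-++-∷ [] suf))
                                  (ListP.++-assoc (reverse suf) _ _))))
               (merge (reverse suf) (reverse pre) j b a 0<b 0<a)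
    where
    reverse-++-∷ : ∀ (xs ys : Word m) {p} → reverse (xs ++ p ∷ ys) ≡ reverse ys ++ p ∷ reverse xs
    reverse-++-∷ xs ys {p} = trans (ListP.reverse-++ xs (p ∷ ys))
      (trans (cong (_++ reverse xs) (ListP.unfold-reverse p ys)) (ListP.++-assoc (reverse ys) _ (reverse xs)))

  ≼-reverse : ∀ {A B : Word m} → A ≼ B → rev A ≼ rev B
  ≼-reverse = gmap rev ⋖-reverse

module _ {m : ℕ} where

  δW : Word m → Word m → ℤ
  δW v w = δ (v ≟W w)

  δF : Fin m → Fin m → ℤ
  δF j j′ = δ (j FinP.≟ j′)

  δW-∷ : ∀ j q (v : Word m) j′ t w → δW ((j , q) ∷ v) ((j′ , t) ∷ w) ≡ δF j j′ * (δℕ q t * δW v w)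
  δW-∷ j q v j′ t w = split (j FinP.≟ j′) (q ℕP.≟ t) (v ≟W w)
    where
    split : (j? : Dec (j ≡ j′)) (q? : Dec (q ≡ t)) (v? : Dec (v ≡ w)) →
            δW ((j , q) ∷ v) ((j′ , t) ∷ w) ≡ δ j? * (δ q? * δ v?)
    split (yes refl) (yes refl) (yes refl) = δ-yes (((j , q) ∷ v) ≟W ((j , q) ∷ v)) refl
    split (no j≢j′)  _          _          =
      δ-no (((j , q) ∷ v) ≟W ((j′ , t) ∷ w)) (j≢j′ ∘ cong proj₁ ∘ ListP.∷-injectiveˡ)
    split (yes refl) (no q≢t)   v?         =
      trans (δ-no (((j , q) ∷ v) ≟W ((j , t) ∷ w)) (q≢t ∘ cong proj₂ ∘ ListP.∷-injectiveˡ))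
            (sym (ℤP.*-identityˡ (0ℤ * δ v?)))
    split (yes refl) (yes refl) (no v≢w)   = δ-no (((j , q) ∷ v) ≟W ((j , q) ∷ w)) (v≢w ∘ ListP.∷-injectiveʳ)

  sgn : Word m → ℤ
  sgn x = sign (len x)

  -- For a composition x, ζ c x y is the coefficient of a monomial with entries c in (∑_{γ ≼ x} M γ) *ₚ M y.
  ζ : Word m → Word m → Word m → ℤ
  ζ c x y = ∑splits c (λ a b → ⟦ positive a ≼ᵇ x ⟧ * δW (positive b) y)

  shiftSum : (Word m → Word m → ℤ) → Word m → Word m → ℤ
  shiftSum Z x []      = sgn x * Z x []
  shiftSum Z x (π ∷ y) = sgn x * Z x (π ∷ y) + shiftSum Z (π ∷ x) y

  shiftSum-cong : ∀ {Z Z′ : Word m → Word m → ℤ} → (∀ x y → Z x y ≡ Z′ x y) →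
                  ∀ x y → shiftSum Z x y ≡ shiftSum Z′ x y
  shiftSum-cong Z≗Z′ x []      = cong (sgn x *_) (Z≗Z′ x [])
  shiftSum-cong Z≗Z′ x (π ∷ y) = cong₂ _+_ (cong (sgn x *_) (Z≗Z′ x (π ∷ y))) (shiftSum-cong Z≗Z′ (π ∷ x) y)

  shiftSum-upTo : ∀ (Z : Word m → Word m → ℤ) x y →
    shiftSum Z x y ≡ ∑ (upTo (suc (length y))) (λ k → sgn (take k y ʳ++ x) * Z (take k y ʳ++ x) (drop k y))
  shiftSum-upTo Z x []      = sym (ℤP.+-identityʳ (sgn x * Z x []))
  shiftSum-upTo Z x (π ∷ y) = trans (cong (sgn x * Z x (π ∷ y) +_) (shiftSum-upTo Z (π ∷ x) y))
    (sym (∑-upTo-suc (suc (length y)) (λ k → sgn (take k (π ∷ y) ʳ++ x) * Z (take k (π ∷ y) ʳ++ x) (drop k (π ∷ y)))))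

  shiftSum-telescopes : (Z U V : Word m → Word m → ℤ) →
    (∀ x y → Z x y ≡ U x y + V x y) → (∀ x → U x [] ≡ 0ℤ) →
    (∀ x j t y → 0 < t → U x ((j , t) ∷ y) ≡ V ((j , t) ∷ x) y) →
    ∀ x y → IsComp y → shiftSum Z x y ≡ sgn x * V x y
  shiftSum-telescopes Z U V Z≡U+V U-[] U≡V-shift x [] [] =
    cong (sgn x *_) (trans (Z≡U+V x []) (trans (cong (_+ V x []) (U-[] x)) (ℤP.+-identityˡ _)))
  shiftSum-telescopes Z U V Z≡U+V U-[] U≡V-shift x ((j , t) ∷ y) (0<t ∷ comp) = begin
    sgn x * Z x πy + shiftSum Z (π ∷ x) y
      ≡⟨ cong₂ _+_ (cong (sgn x *_) (Z≡U+V x πy)) (shiftSum-telescopes Z U V Z≡U+V U-[] U≡V-shift (π ∷ x) y comp) ⟩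
    sgn x * (U x πy + V x πy) + (- sgn x) * V (π ∷ x) y
      ≡⟨ cong (λ u → sgn x * (u + V x πy) + (- sgn x) * V (π ∷ x) y) (U≡V-shift x j t y 0<t) ⟩
    sgn x * (V (π ∷ x) y + V x πy) + (- sgn x) * V (π ∷ x) y
      ≡⟨ cancel (sgn x) (V (π ∷ x) y) (V x πy) ⟩
    sgn x * V x πy ∎
    where
    π = (j , t)
    πy = π ∷ y
    cancel : ∀ s u v → s * (u + v) + (- s) * u ≡ s * v
    cancel = solve-∀

  -- U collects the terms of ζ ((j , n) ∷ c) in which the right factor receives part of the
  -- first entry (j , n), V the others.
  module LeadingEntry (j : Fin m) (n′ : ℕ) (c : Word m) where

    n : ℕ
    n = suc n′

    H : ℕ → Word m → Word m → ℤ
    H p x y = ∑splits c (λ a b → ⟦ positive ((j , p) ∷ a) ≼ᵇ x ⟧ * δW (positive b) y)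

    term : ℕ → ℕ → Word m → Word m → ℤ
    term p q x y = ∑splits c (λ a b → ⟦ positive ((j , p) ∷ a) ≼ᵇ x ⟧ * δW (positive ((j , q) ∷ b)) y)

    termʳ termˡ : ℕ → ℕ → Word m → Word m → ℤ
    termʳ p zero    x y = 0ℤ
    termʳ p (suc q) x y = term p (suc q) x y
    termˡ p zero    x y = H p x y
    termˡ p (suc q) x y = 0ℤ

    U V : Word m → Word m → ℤ
    U x y = ∑ (splitsℕ n) (λ pq → termʳ (proj₁ pq) (proj₂ pq) x y)
    V x y = ∑ (splitsℕ n) (λ pq → termˡ (proj₁ pq) (proj₂ pq) x y)

    ζ≡U+V : ∀ x y → ζ ((j , n) ∷ c) x y ≡ U x y + V x y
    ζ≡U+V x y = begin
      ζ ((j , n) ∷ c) x y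
        ≡⟨ ∑splits-∷ j n c _ ⟩
      ∑ (splitsℕ n) (λ pq → term (proj₁ pq) (proj₂ pq) x y)
        ≡⟨ ∑-cong (splitsℕ n) (λ pq → term≡ (proj₁ pq) (proj₂ pq)) ⟩
      ∑ (splitsℕ n) (λ pq → termʳ (proj₁ pq) (proj₂ pq) x y + termˡ (proj₁ pq) (proj₂ pq) x y)
        ≡⟨ ∑-+ (splitsℕ n) (λ pq → termʳ (proj₁ pq) (proj₂ pq) x y)
                           (λ pq → termˡ (proj₁ pq) (proj₂ pq) x y) ⟩
      U x y + V x y ∎
      where
      term≡ : ∀ p q → term p q x y ≡ termʳ p q x y + termˡ p q x y
      term≡ p zero    = sym (ℤP.+-identityˡ _)
      term≡ p (suc q) = sym (ℤP.+-identityʳ _)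

    U-[] : ∀ x → U x [] ≡ 0ℤ
    U-[] x = ∑-zero (splitsℕ n) (λ pq → termʳ-[] (proj₁ pq) (proj₂ pq))
      where
      termʳ-[] : ∀ p q → termʳ p q x [] ≡ 0ℤ
      termʳ-[] p zero    = refl
      termʳ-[] p (suc q) = ∑splits-zero c (λ a b → ℤP.*-zeroʳ ⟦ positive ((j , p) ∷ a) ≼ᵇ x ⟧)

    V≡H : ∀ x y → V x y ≡ H n x y
    V≡H x y = trans (∑-cong (splitsℕ n) (λ pq → termˡ≡ (proj₁ pq) (proj₂ pq)))
                    (∑-splitsℕ-select n 0 (λ p → H p x y) z≤n)
      where
      termˡ≡ : ∀ p q → termˡ p q x y ≡ δℕ q 0 * H p x y
      termˡ≡ p zero    = sym (ℤP.*-identityˡ (H p x y))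
      termˡ≡ p (suc q) = refl

    shifted : Fin m → ℕ → Word m → Word m → ℤ
    shifted j′ t x y = δF j j′ * ∑ (splitsℕ n) (λ pq → δℕ (proj₂ pq) t * H (proj₁ pq) x y)

    U-∷ : ∀ x j′ t y → 0 < t → U x ((j′ , t) ∷ y) ≡ shifted j′ t x y
    U-∷ x j′ t y 0<t =
      trans (∑-cong (splitsℕ n) (λ pq → termʳ≡ (proj₁ pq) (proj₂ pq)))
            (sym (*-∑ (δF j j′) (splitsℕ n) (λ pq → δℕ (proj₂ pq) t * H (proj₁ pq) x y)))
      where
      termʳ≡ : ∀ p q → termʳ p q x ((j′ , t) ∷ y) ≡ δF j j′ * (δℕ q t * H p x y)
      termʳ≡ p zero    = sym (trans (cong (λ d → δF j j′ * (d * H p x y)) (δ-no (0 ℕP.≟ t) (ℕP.<⇒≢ 0<t)))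
                                    (ℤP.*-zeroʳ (δF j j′)))
      termʳ≡ p (suc q) = begin
        ∑splits c (λ a b → ⟦ positive ((j , p) ∷ a) ≼ᵇ x ⟧ * δW ((j , suc q) ∷ positive b) ((j′ , t) ∷ y))
          ≡⟨ ∑splits-cong c (λ a b → cong (⟦ positive ((j , p) ∷ a) ≼ᵇ x ⟧ *_)
                                          (δW-∷ j (suc q) (positive b) j′ t y)) ⟩
        ∑splits c (λ a b → ⟦ positive ((j , p) ∷ a) ≼ᵇ x ⟧ * (δF j j′ * (δℕ (suc q) t * δW (positive b) y)))
          ≡⟨ ∑splits-cong c (λ a b → pull ⟦ positive ((j , p) ∷ a) ≼ᵇ x ⟧ (δF j j′) (δℕ (suc q) t)
                                          (δW (positive b) y)) ⟩
        ∑splits c (λ a b → δF j j′ * δℕ (suc q) t * (⟦ positive ((j , p) ∷ a) ≼ᵇ x ⟧ * δW (positive b) y))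
          ≡⟨ *-∑ (δF j j′ * δℕ (suc q) t) (splitsW c) _ ⟨
        δF j j′ * δℕ (suc q) t * H p x y
          ≡⟨ ℤP.*-assoc (δF j j′) (δℕ (suc q) t) (H p x y) ⟩
        δF j j′ * (δℕ (suc q) t * H p x y) ∎
        where
        pull : ∀ a d e f → a * (d * (e * f)) ≡ d * e * (a * f)
        pull = solve-∀

    V-∷ : ∀ x j′ t y → 0 < t → V ((j′ , t) ∷ x) y ≡ shifted j′ t x y
    V-∷ x j′ t y 0<t = trans (V≡H ((j′ , t) ∷ x) y) (split (j FinP.≟ j′))
      where
      select : ℕ → ℤ
      select p = H p x y

      split : Dec (j ≡ j′) → H n ((j′ , t) ∷ x) y ≡ shifted j′ t x y
      split (no j≢j′) = begin
        H n ((j′ , t) ∷ x) y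
          ≡⟨ ∑splits-zero c (λ a b → cong (λ z → ⟦ z ⟧ * δW (positive b) y)
                                          (≼ᵇ-∷-≢ j n (positive a) j′ t x j≢j′)) ⟩
        0ℤ
          ≡⟨ cong (_* ∑ (splitsℕ n) (λ pq → δℕ (proj₂ pq) t * select (proj₁ pq))) (δ-no (j FinP.≟ j′) j≢j′) ⟨
        shifted j′ t x y ∎
      split (yes refl) = begin
        H n ((j , t) ∷ x) y
          ≡⟨ compare (ℕP.<-cmp t n) ⟩
        ∑ (splitsℕ n) (λ pq → δℕ (proj₂ pq) t * select (proj₁ pq))
          ≡⟨ ℤP.*-identityˡ _ ⟨
        1ℤ * ∑ (splitsℕ n) (λ pq → δℕ (proj₂ pq) t * select (proj₁ pq))
          ≡⟨ cong (_* ∑ (splitsℕ n) (λ pq → δℕ (proj₂ pq) t * select (proj₁ pq))) (δ-yes (j FinP.≟ j) refl) ⟨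
        shifted j t x y ∎
        where
        compare : Tri (t < n) (t ≡ n) (n < t) →
                  H n ((j , t) ∷ x) y ≡ ∑ (splitsℕ n) (λ pq → δℕ (proj₂ pq) t * select (proj₁ pq))
        compare (tri< t<n _ _) = begin
          H n ((j , t) ∷ x) y
            ≡⟨ ∑splits-cong c (λ a b → cong (λ z → ⟦ z ⟧ * δW (positive b) y)
                 (trans (≼ᵇ-∷-> j n (positive a) t x 0<t t<n)
                        (cong (_≼ᵇ x) (sym (positive-∷ j a (ℕP.m<n⇒0<n∸m t<n)))))) ⟩
          H (n ∸ t) x y
            ≡⟨ ∑-splitsℕ-select n t select (ℕP.<⇒≤ t<n) ⟨
          ∑ (splitsℕ n) (λ pq → δℕ (proj₂ pq) t * select (proj₁ pq)) ∎
        compare (tri≈ _ refl _) = begin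
          H n ((j , n) ∷ x) y
            ≡⟨ ∑splits-cong c (λ a b → cong (λ z → ⟦ z ⟧ * δW (positive b) y)
                                            (≼ᵇ-∷-≡ j n (positive a) n x 0<t refl)) ⟩
          H 0 x y
            ≡⟨ cong select (ℕP.n∸n≡0 n) ⟨
          H (n ∸ n) x y
            ≡⟨ ∑-splitsℕ-select n n select ℕP.≤-refl ⟨
          ∑ (splitsℕ n) (λ pq → δℕ (proj₂ pq) n * select (proj₁ pq)) ∎
        compare (tri> _ _ n<t) = begin
          H n ((j , t) ∷ x) y
            ≡⟨ ∑splits-zero c (λ a b → cong (λ z → ⟦ z ⟧ * δW (positive b) y)
                                            (≼ᵇ-∷-< j n (positive a) t x n<t)) ⟩
          0ℤ
            ≡⟨ ∑-splitsℕ-select-> n t select n<t ⟨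
          ∑ (splitsℕ n) (λ pq → δℕ (proj₂ pq) t * select (proj₁ pq)) ∎

  shiftSum-ζ-vanishes : ∀ c π α → IsComp (π ∷ α) → shiftSum (ζ c) [] (π ∷ α) ≡ 0ℤ
  shiftSum-ζ-vanishes [] π α comp =
    shiftSum-telescopes (ζ []) (λ _ _ → 0ℤ) (ζ []) (λ _ _ → sym (ℤP.+-identityˡ _)) (λ _ → refl)
                        (λ _ _ _ _ _ → refl) [] (π ∷ α) comp
  shiftSum-ζ-vanishes ((j , zero) ∷ c) π α comp =
    trans (shiftSum-cong {ζ ((j , 0) ∷ c)} {ζ c} (λ x y → trans (∑splits-∷ j 0 c _) (ℤP.+-identityʳ _)) [] (π ∷ α))
          (shiftSum-ζ-vanishes c π α comp)
  shiftSum-ζ-vanishes ((j , suc n′) ∷ c) π α comp = begin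
    shiftSum (ζ ((j , n) ∷ c)) [] (π ∷ α)
      ≡⟨ shiftSum-telescopes (ζ ((j , n) ∷ c)) U V ζ≡U+V U-[]
           (λ x j′ t y 0<t → trans (U-∷ x j′ t y 0<t) (sym (V-∷ x j′ t y 0<t))) [] (π ∷ α) comp ⟩
    1ℤ * V [] (π ∷ α)
      ≡⟨ ℤP.*-identityˡ _ ⟩
    V [] (π ∷ α)
      ≡⟨ V≡H [] (π ∷ α) ⟩
    H n [] (π ∷ α)
      ≡⟨ ∑splits-zero c (λ _ _ → refl) ⟩
    0ℤ ∎
    where open LeadingEntry j n′ c

module _ {m : ℕ} where

  *ₚ-congʳ : ∀ {f g : PS m} (h : PS m) → f ≈ g → f *ₚ h ≈ g *ₚ h
  *ₚ-congʳ h f≈g e = ∑-cong (splitsMono e) (λ uw → cong (_* h (proj₂ uw)) (f≈g (proj₁ uw)))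

  *ₚ-congˡ : ∀ (f : PS m) {g h : PS m} → g ≈ h → f *ₚ g ≈ f *ₚ h
  *ₚ-congˡ f g≈h e = ∑-cong (splitsMono e) (λ uw → cong (f (proj₁ uw) *_) (g≈h (proj₂ uw)))

  convolution : (Word m → PS m) → Word m → PS m
  convolution S α = sumₚ (map (λ βγ → S (proj₁ βγ) *ₚ M (proj₂ βγ)) (deconcat α))

  IsLeftAntipode : (Word m → PS m) → Set
  IsLeftAntipode S = ∀ α → IsComp α → convolution S α ≈ εW α ·ₚ 1ₚ

  convolution-upTo : ∀ S α e →
    convolution S α e ≡ ∑ (upTo (suc (length α))) (λ k → (S (take k α) *ₚ M (drop k α)) e)
  convolution-upTo S α e =
    trans (sumₚ-apply (λ βγ → S (proj₁ βγ) *ₚ M (proj₂ βγ)) (deconcat α) e)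
          (∑-map (λ k → take k α , drop k α) (upTo (suc (length α))) (λ βγ → (S (proj₁ βγ) *ₚ M (proj₂ βγ)) e))

  convolution-last : ∀ S α e →
    convolution S α e ≡ ∑ (upTo (length α)) (λ k → (S (take k α) *ₚ M (drop k α)) e) + S α e
  convolution-last S α e = begin
    convolution S α e
      ≡⟨ convolution-upTo S α e ⟩
    ∑ (upTo (suc (length α))) term
      ≡⟨ cong (λ ks → ∑ ks term) (ListP.upTo-∷ʳ (length α)) ⟨
    ∑ (upTo (length α) List.∷ʳ length α) term
      ≡⟨ ∑-++ (upTo (length α)) (length α ∷ []) term ⟩
    ∑ (upTo (length α)) term + (term (length α) + 0ℤ)
      ≡⟨ cong (∑ (upTo (length α)) term +_) (begin
           term (length α) + 0ℤ                       ≡⟨ ℤP.+-identityʳ _ ⟩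
           (S (take l α) *ₚ M (drop l α)) e           ≡⟨ cong₂ (λ β γ → (S β *ₚ M γ) e) (ListP.take-all l α ℕP.≤-refl)
                                                                                         (ListP.drop-all l α ℕP.≤-refl) ⟩
           (S α *ₚ M []) e                             ≡⟨ *ₚ-congˡ (S α) M[]≈1ₚ e ⟩
           (S α *ₚ 1ₚ) e                               ≡⟨ *ₚ-identityʳ (S α) e ⟩
           S α e                                       ∎) ⟩
    ∑ (upTo (length α)) term + S α e ∎
    where
    l = length α
    term : ℕ → ℤ
    term k = (S (take k α) *ₚ M (drop k α)) e

  left-antipode-unique : ∀ S T → IsLeftAntipode S → IsLeftAntipode T → ∀ α → IsComp α → S α ≈ T α
  left-antipode-unique S T S-anti T-anti α = unique-< (suc (length α)) α ℕP.≤-refl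
    where
    unique-< : ∀ n α → length α < n → IsComp α → S α ≈ T α
    unique-< (suc n) α |α|<1+n comp e = +-cancelˡ (∑ (upTo (length α)) (termWith S)) (S α e) (T α e) (begin
      ∑ (upTo (length α)) (termWith S) + S α e   ≡⟨ convolution-last S α e ⟨
      convolution S α e                          ≡⟨ S-anti α comp e ⟩
      εW α * 1ₚ e                                ≡⟨ T-anti α comp e ⟨
      convolution T α e                          ≡⟨ convolution-last T α e ⟩
      ∑ (upTo (length α)) (termWith T) + T α e   ≡⟨ cong (_+ T α e) prefixes-agree ⟨
      ∑ (upTo (length α)) (termWith S) + T α e   ∎)
      where
      termWith : (Word m → PS m) → ℕ → ℤ
      termWith R k = (R (take k α) *ₚ M (drop k α)) e

      prefixes-agree : ∑ (upTo (length α)) (termWith S) ≡ ∑ (upTo (length α)) (termWith T)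
      prefixes-agree = ∑-upTo-cong (length α) (λ k k<|α| →
        *ₚ-congʳ (M (drop k α))
          (unique-< n (take k α)
             (ℕP.≤-<-trans (ℕP.≤-trans (ℕP.≤-reflexive (ListP.length-take k α)) (ℕP.m⊓n≤m k (length α)))
                           (ℕP.<-≤-trans k<|α| (ℕ.s≤s⁻¹ |α|<1+n)))
             (AllP.take⁺ k comp)) e)

  antipodeFormula : Word m → PS m
  antipodeFormula β u = sgn β * ⟦ support u ≼ᵇ rev β ⟧

  antipodeFormula-*ₚ-M : ∀ β γ e → (antipodeFormula β *ₚ M γ) e ≡ sgn β * ζ (entries e) (rev β) γ
  antipodeFormula-*ₚ-M β γ e = begin
    (antipodeFormula β *ₚ M γ) e
      ≡⟨ *ₚ-support (λ w → sgn β * ⟦ w ≼ᵇ rev β ⟧) (λ w → δW w γ) e ⟩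
    ∑splits (entries e) (λ a b → sgn β * ⟦ positive a ≼ᵇ rev β ⟧ * δW (positive b) γ)
      ≡⟨ ∑splits-cong (entries e) (λ a b → ℤP.*-assoc (sgn β) _ _) ⟩
    ∑splits (entries e) (λ a b → sgn β * (⟦ positive a ≼ᵇ rev β ⟧ * δW (positive b) γ))
      ≡⟨ *-∑ (sgn β) (splitsW (entries e)) _ ⟨
    sgn β * ζ (entries e) (rev β) γ ∎

  antipodeFormula-isLeftAntipode : IsLeftAntipode antipodeFormula
  antipodeFormula-isLeftAntipode [] _ e = begin
    convolution antipodeFormula [] e  ≡⟨ convolution-last antipodeFormula [] e ⟩
    0ℤ + 1ℤ * ⟦ support e ≼ᵇ [] ⟧     ≡⟨ ℤP.+-identityˡ _ ⟩
    1ℤ * ⟦ support e ≼ᵇ [] ⟧          ≡⟨ cong (λ b → 1ℤ * ⟦ b ⟧) (≼ᵇ-[] (support e)) ⟩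
    1ℤ * ⟦ null (support e) ⟧         ≡⟨ cong (λ b → 1ℤ * ⟦ b ⟧) (isZeroMono-support e) ⟨
    1ℤ * 1ₚ e                         ∎
    where
    ≼ᵇ-[] : ∀ (w : Word m) → w ≼ᵇ [] ≡ null w
    ≼ᵇ-[] []      = refl
    ≼ᵇ-[] (_ ∷ _) = refl
  antipodeFormula-isLeftAntipode (π ∷ α) comp e = begin
    convolution antipodeFormula (π ∷ α) e
      ≡⟨ convolution-upTo antipodeFormula (π ∷ α) e ⟩
    ∑ (upTo (suc (length (π ∷ α)))) (λ k → (antipodeFormula (take k (π ∷ α)) *ₚ M (drop k (π ∷ α))) e)
      ≡⟨ ∑-cong (upTo (suc (length (π ∷ α)))) (λ k → trans
           (antipodeFormula-*ₚ-M (take k (π ∷ α)) (drop k (π ∷ α)) e)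
           (cong (λ l → sign l * ζ (entries e) (rev (take k (π ∷ α))) (drop k (π ∷ α)))
                 (sym (ListP.length-reverse (take k (π ∷ α)))))) ⟩
    ∑ (upTo (suc (length (π ∷ α)))) (λ k → sgn (rev (take k (π ∷ α))) *
                                           ζ (entries e) (rev (take k (π ∷ α))) (drop k (π ∷ α)))
      ≡⟨ shiftSum-upTo (ζ (entries e)) [] (π ∷ α) ⟨
    shiftSum (ζ (entries e)) [] (π ∷ α)
      ≡⟨ shiftSum-ζ-vanishes (entries e) π α comp ⟩
    0ℤ ∎

  IsComp-reverse : ∀ {α : Word m} → IsComp α → IsComp (rev α)
  IsComp-reverse comp = All.tabulate (λ p∈rev → All.lookup comp (AnyP.reverse⁻ p∈rev))

  open import Data.List.Membership.DecPropositional (_≟W_ {m}) using (_∈?_)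

  ∑-δ-Unique : ∀ (cs : List (Word m)) → Unique cs → ∀ v → ∑ cs (λ β → δ (v ≟W β)) ≡ δ (v ∈? cs)
  ∑-δ-Unique []       []               v = refl
  ∑-δ-Unique (β ∷ cs) (β∉cs ∷ unique) v = split (v ≟W β)
    where
    split : Dec (v ≡ β) → δ (v ≟W β) + ∑ cs (λ β′ → δ (v ≟W β′)) ≡ δ (v ∈? (β ∷ cs))
    split (yes refl) = begin
      δ (v ≟W v) + ∑ cs (λ β′ → δ (v ≟W β′))  ≡⟨ cong₂ _+_ (δ-yes (v ≟W v) refl) (∑-δ-Unique cs unique v) ⟩
      1ℤ + δ (v ∈? cs)                        ≡⟨ cong (1ℤ +_) (δ-no (v ∈? cs) (λ v∈cs → All.lookup β∉cs v∈cs refl)) ⟩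
      1ℤ                                      ≡⟨ δ-yes (v ∈? (v ∷ cs)) (here refl) ⟨
      δ (v ∈? (v ∷ cs))                       ∎
    split (no v≢β) = begin
      δ (v ≟W β) + ∑ cs (λ β′ → δ (v ≟W β′))  ≡⟨ cong₂ _+_ (δ-no (v ≟W β) v≢β) (∑-δ-Unique cs unique v) ⟩
      0ℤ + δ (v ∈? cs)                        ≡⟨ ℤP.+-identityˡ _ ⟩
      δ (v ∈? cs)                             ≡⟨ δ-cong (v ∈? cs) (v ∈? (β ∷ cs)) there
                                                   (λ { (here v≡β) → ⊥-elim (v≢β v≡β) ; (there v∈cs) → v∈cs }) ⟩
      δ (v ∈? (β ∷ cs))                       ∎

  sumₚ-M-reverse : ∀ (α : Word m) → IsComp α → (cs : List (Word m)) → Unique cs → (∀ β → (β ∈ cs) ⇔ (β ≼ α)) →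
                   ∀ e → sumₚ (map (λ β → M (rev β)) cs) e ≡ ⟦ support e ≼ᵇ rev α ⟧
  sumₚ-M-reverse α comp cs unique cs≡≼α e = begin
    sumₚ (map (λ β → M (rev β)) cs) e  ≡⟨ sumₚ-apply (λ β → M (rev β)) cs e ⟩
    ∑ cs (λ β → δ (w ≟W rev β))        ≡⟨ ∑-cong cs (λ β → δ-cong (w ≟W rev β) (rev w ≟W β)
                                            (λ w≡β′ → trans (cong rev w≡β′) (ListP.reverse-involutive β))
                                            (λ w′≡β → trans (sym (ListP.reverse-involutive w)) (cong rev w′≡β))) ⟩
    ∑ cs (λ β → δ (rev w ≟W β))        ≡⟨ ∑-δ-Unique cs unique (rev w) ⟩
    δ (rev w ∈? cs)                    ≡⟨ δ-⟦⟧ (rev w ∈? cs) (w ≼ᵇ rev α) member⇒≼ᵇ ≼ᵇ⇒member ⟩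
    ⟦ w ≼ᵇ rev α ⟧                     ∎
    where
    w = support e

    member⇒≼ᵇ : rev w ∈ cs → w ≼ᵇ rev α ≡ true
    member⇒≼ᵇ = ≼⇒≼ᵇ (IsComp-reverse comp) ∘ subst (_≼ rev α) (ListP.reverse-involutive w)
              ∘ ≼-reverse ∘ Equivalence.to (cs≡≼α (rev w))

    ≼ᵇ⇒member : w ≼ᵇ rev α ≡ true → rev w ∈ cs
    ≼ᵇ⇒member = Equivalence.from (cs≡≼α (rev w)) ∘ subst (rev w ≼_) (ListP.reverse-involutive α)
              ∘ ≼-reverse ∘ ≼ᵇ⇒≼ w (rev α)

mainTheorem9 : (m : ℕ) → 1 ≤ m →
    (S : Word m → PS m) → IsAntipode S →
    (α : Word m) → IsComp α →
    (cs : List (Word m)) → Unique cs → (∀ β → (β ∈ cs) ⇔ (β ≼ α)) →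
    S α ≈ sign (len α) ·ₚ sumₚ (map (λ β → M (rev β)) cs)
mainTheorem9 m _ S (S-isLeftAntipode , _) α comp cs unique cs≡≼α e = begin
  S α e
    ≡⟨ left-antipode-unique S antipodeFormula S-isLeftAntipode antipodeFormula-isLeftAntipode α comp e ⟩
  sign (len α) * ⟦ support e ≼ᵇ rev α ⟧
    ≡⟨ cong (sign (len α) *_) (sumₚ-M-reverse α comp cs unique cs≡≼α e) ⟨
  sign (len α) * sumₚ (map (λ β → M (rev β)) cs) e ∎
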